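{- Let $(G,F,\mathcal{C})$ be a framework. Then: (1) $F$ is an induced subgraph of $G$. (2) Every edge $e\in E(G)\setminus E(F)$ belongs to at least two members of $\mathcal{C}$; it belongs to more than two if and only if $e$ is an end-edge of a path in $\mathcal{C}$ and neither end of $e$ is in $V(F)$, and in this case $e$ belongs to exactly four members of $\mathcal{C}$, all of them paths, and $e$ is an end-edge of each of them. (3) For every two edges $e,f$ of $G$ with a common end that has degree three in $G\setminus E(F)$, there is at most one $C\in\mathcal{C}$ with $e,f\in E(C)$.
   Context: All graphs are finite and simple; paths and circuits have no repeated vertices. The ends of a path are its first and last vertices, its end-edges its first and last edges. For a set of edges $E'$, $G\setminus E'$ is obtained from $G$ by deleting those edges (keeping all vertices). For a path or circuit $C$, a sequence of vertices/edges is "in order" in $C$ if they are met in that order traversing $C$ (from one end if $C$ is a path; from some starting point if $C$ is a circuit). A framework is a triple $(G,F,\mathcal{C})$ where $G$ is cubic, $F$ is a subgraph of $G$, and $\mathcal{C}$ is a set of subgraphs of $G\setminus E(F)$, satisfying (F1)–(F7) below. Distinct edges $e,f$ are twinned if there exist distinct $C_1,C_2\in\mathcal{C}$ with $e,f\in E(C_1\cap C_2)$. (F1) Each member of $\mathcal{C}$ is an induced subgraph of $G\setminus E(F)$, has at least three edges, and is a path or a circuit. (F2) Every edge of $G\setminus E(F)$ belongs to some member of $\mathcal{C}$, and for every two edges $e,f$ of $G$ with a common end not in $V(F)$ there exists $C\in\mathcal{C}$ with $e,f\in E(C)$. (F3) If $C_1,C_2\in\mathcal{C}$ are distinct and $v\in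 V(C_1\cap C_2)$, then either $V(C_1\cap C_2)=\{v\}$, or $v$ is incident with an edge of $C_1\cap C_2$, or $v\in V(F)$. (F4) If $C_1\in\mathcal{C}$ is a path, every member of $\mathcal{C}$ containing an end-edge of $C_1$ is a path; and if $C_2\in\mathcal{C}\setminus\{C_1\}$ is also a path, then every component of $C_1\cap C_2$ contains an end of $C_1$, and every edge of $C_1\cap C_2$ is an end-edge of $C_1$. (F5) If $C\in\mathcal{C}$ is a circuit then $|V(C\cap F)|\le 1$ and every vertex of $C\cap F$ has degree 1 in $F$; if $C\in\mathcal{C}$ is a path then every vertex of $C\cap F$ is an end of $C$ and has degree 0 or 2 in $F$. (F6) If $e,f$ are twinned and $C\in\mathcal{C}$ with $e\in E(C)$, then $|V(C)|\le 6$ and either: $f\in E(C)$, $C$ is a circuit, $e,f$ have a common end in $V(F)$, and no path in $\mathcal{C}$ contains any vertex of $e$ or $f$; or $f\in E(C)$, $C$ is a path with end-edges $e,f$, and $C\cap F$ is null; or $f\notin E(C)$, $C$ is a path with $|E(C)|=3$, $e$ is an end-edge of $C$, and no end of $e$ is in $V(F)$. (F7) Let $C\in\mathcal{C}$ be a path of length five with twinned end-edges $e,f$. Then $|E(C')|\le 4$ for every path $C'\in\mathcal{C}\setminus\{C\}$ containing $e$. Moreover, let $C$ have vertices $v_0,v_1,\dots,v_5$ in order; then there exists $C'\in\mathcal{C}$ with end-edges $e$ and $f$ and with ends $v_0$ and $v_4$. -}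

module Defs where

open import Data.Nat using (ℕ; zero; suc; _+_; _≤_; _<_)
open import Data.Fin using (Fin; zero; suc; inject₁; fromℕ; _≟_; #_)
open import Data.Fin.Subset using (Subset; _∈_; _∉_; _⊆_; _∩_; ∁; ⊤; ∣_∣)
open import Data.Fin.Subset.Properties using (∈⊤)
open import Data.Vec using (tabulate; lookup)
open import Data.Bool using (_∨_)
open import Data.Product using (Σ; ∃; ∃-syntax; _×_; _,_; proj₁; proj₂)
open import Data.Sum using (_⊎_)
open import Relation.Nullary using (¬_; does)
open import Relation.Binary.PropositionalEquality using (_≡_; _≢_)
open import Function.Bundles using (_⇔_)

-- Finite simple graphs: vertices Fin n, edges Fin m, each edge has two
-- (ordered, but only the unordered pair matters) distinct ends, and no
-- two distinct edges join the same pair of vertices.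

record Graph : Set where
  field
    n     : ℕ
    m     : ℕ
    ends  : Fin m → Fin n × Fin n
    loopless : ∀ e → proj₁ (ends e) ≢ proj₂ (ends e)

  Inc : Fin n → Fin m → Set
  Inc v e = (v ≡ proj₁ (ends e)) ⊎ (v ≡ proj₂ (ends e))

  Joins : Fin m → Fin n → Fin n → Set
  Joins e u v = (proj₁ (ends e) ≡ u × proj₂ (ends e) ≡ v)
              ⊎ (proj₁ (ends e) ≡ v × proj₂ (ends e) ≡ u)

  field
    simple : ∀ e f u v → Joins e u v → Joins f u v → e ≡ f

  incSet : Fin n → Subset m
  incSet v = tabulate (λ e → does (v ≟ proj₁ (ends e)) ∨ does (v ≟ proj₂ (ends e)))

open Graph public

Cubic : Graph → Set
Cubic G = ∀ v → ∣ incSet G v ∣ ≡ 3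

record Subgraph (G : Graph) : Set where
  field
    V : Subset (n G)
    E : Subset (m G)
    closed : ∀ e → e ∈ E → proj₁ (ends G e) ∈ V × proj₂ (ends G e) ∈ V

open Subgraph public

module _ {G : Graph} where

  deg : Subgraph G → Fin (n G) → ℕ
  deg H v = ∣ E H ∩ incSet G v ∣

  InducedIn : Subgraph G → Subgraph G → Set
  InducedIn H' H = (V H' ⊆ V H) × (E H' ⊆ E H)
    × (∀ e → e ∈ E H → proj₁ (ends G e) ∈ V H' → proj₂ (ends G e) ∈ V H' → e ∈ E H')

  record PathW (H : Subgraph G) (k : ℕ) : Set where
    field
      vs : Fin (suc k) → Fin (n G)
      es : Fin k → Fin (m G)
      vs-inj : ∀ i j → vs i ≡ vs j → i ≡ j
      es-join : ∀ i → Joins G (es i) (vs (inject₁ i)) (vs (suc i))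
      V-exact : ∀ x → x ∈ V H ⇔ (∃[ i ] vs i ≡ x)
      E-exact : ∀ e → e ∈ E H ⇔ (∃[ i ] es i ≡ e)

  open PathW public

  record CircW (H : Subgraph G) (k : ℕ) : Set where
    field
      cvs : Fin (3 + k) → Fin (n G)
      ces : Fin (3 + k) → Fin (m G)
      cvs-inj : ∀ i j → cvs i ≡ cvs j → i ≡ j
      ces-join : ∀ (i : Fin (2 + k)) → Joins G (ces (inject₁ i)) (cvs (inject₁ i)) (cvs (suc i))
      ces-close : Joins G (ces (fromℕ (2 + k))) (cvs (fromℕ (2 + k))) (cvs zero)
      cV-exact : ∀ x → x ∈ V H ⇔ (∃[ i ] cvs i ≡ x)
      cE-exact : ∀ e → e ∈ E H ⇔ (∃[ i ] ces i ≡ e)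

  IsPath : Subgraph G → Set
  IsPath H = ∃[ k ] PathW H k

  IsCircuit : Subgraph G → Set
  IsCircuit H = ∃[ k ] CircW H k

  End : Subgraph G → Fin (n G) → Set
  End H x = ∃[ k ] Σ (PathW H k) λ w → vs w zero ≡ x

  EndEdge : Subgraph G → Fin (m G) → Set
  EndEdge H e = ∃[ k ] Σ (PathW H (suc k)) λ w → es w zero ≡ e

  EndEdges : Subgraph G → Fin (m G) → Fin (m G) → Set
  EndEdges H e f = ∃[ k ] Σ (PathW H (suc k)) λ w → es w zero ≡ e × es w (fromℕ k) ≡ f

  data Reach (VS : Subset (n G)) (ES : Subset (m G)) : Fin (n G) → Fin (n G) → Set where
    here : ∀ {x} → x ∈ VS → Reach VS ES x x
    step : ∀ {x z y} e → x ∈ VS → e ∈ ES → Joins G e x z → Reach VS ES z y → Reach VS ES x y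

  whole : Subgraph G
  whole = record { V = ⊤ ; E = ⊤ ; closed = λ _ _ → ∈⊤ , ∈⊤ }

  minusE : Subgraph G → Subgraph G
  minusE F = record { V = ⊤ ; E = ∁ (E F) ; closed = λ _ _ → ∈⊤ , ∈⊤ }

-- Frameworks (G, F, 𝒞); 𝒞 is a finite set of subgraphs, represented as
-- a family indexed by Fin c without repetitions.

record Framework : Set₁ where
  field
    G  : Graph
    F  : Subgraph G
    c  : ℕ
    𝒞  : Fin c → Subgraph G
    cubic : Cubic G
    𝒞-set : ∀ i j → V (𝒞 i) ≡ V (𝒞 j) → E (𝒞 i) ≡ E (𝒞 j) → i ≡ j
    𝒞-sub : ∀ i e → e ∈ E (𝒞 i) → e ∉ E F

  GF : Subgraph G
  GF = minusE F

  Twinned : Fin (m G) → Fin (m G) → Set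
  Twinned e f = e ≢ f × ∃[ i ] ∃[ j ] (i ≢ j × e ∈ E (𝒞 i) × f ∈ E (𝒞 i) × e ∈ E (𝒞 j) × f ∈ E (𝒞 j))

  field
    F1 : ∀ i → InducedIn (𝒞 i) GF × 3 ≤ ∣ E (𝒞 i) ∣ × (IsPath (𝒞 i) ⊎ IsCircuit (𝒞 i))
    F2a : ∀ e → e ∉ E F → ∃[ i ] e ∈ E (𝒞 i)
    F2b : ∀ e f v → e ≢ f → Inc G v e → Inc G v f → v ∉ V F
          → ∃[ i ] (e ∈ E (𝒞 i) × f ∈ E (𝒞 i))
    F3 : ∀ i j → i ≢ j → ∀ v → v ∈ V (𝒞 i) → v ∈ V (𝒞 j)
         → (∀ w → w ∈ V (𝒞 i) → w ∈ V (𝒞 j) → w ≡ v)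
           ⊎ (∃[ e ] (e ∈ E (𝒞 i) × e ∈ E (𝒞 j) × Inc G v e))
           ⊎ v ∈ V F
    F4a : ∀ i j e → IsPath (𝒞 i) → EndEdge (𝒞 i) e → e ∈ E (𝒞 j) → IsPath (𝒞 j)
    F4b : ∀ i j → i ≢ j → IsPath (𝒞 i) → IsPath (𝒞 j)
          → ∀ x → x ∈ V (𝒞 i) → x ∈ V (𝒞 j)
          → ∃[ y ] (End (𝒞 i) y × Reach {G} (V (𝒞 i) ∩ V (𝒞 j)) (E (𝒞 i) ∩ E (𝒞 j)) x y)
    F4c : ∀ i j → i ≢ j → IsPath (𝒞 i) → IsPath (𝒞 j)
          → ∀ e → e ∈ E (𝒞 i) → e ∈ E (𝒞 j) → EndEdge (𝒞 i) e
    F5a : ∀ i → IsCircuit (𝒞 i)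
          → ∣ V (𝒞 i) ∩ V F ∣ ≤ 1 × (∀ v → v ∈ V (𝒞 i) → v ∈ V F → deg F v ≡ 1)
    F5b : ∀ i → IsPath (𝒞 i) → ∀ v → v ∈ V (𝒞 i) → v ∈ V F
          → End (𝒞 i) v × (deg F v ≡ 0 ⊎ deg F v ≡ 2)
    F6 : ∀ e f → Twinned e f → ∀ i → e ∈ E (𝒞 i)
         → ∣ V (𝒞 i) ∣ ≤ 6
           × ( (f ∈ E (𝒞 i) × IsCircuit (𝒞 i)
                 × (∃[ v ] (Inc G v e × Inc G v f × v ∈ V F))
                 × (∀ j → IsPath (𝒞 j) → ∀ v → (Inc G v e ⊎ Inc G v f) → v ∉ V (𝒞 j)))
             ⊎ (f ∈ E (𝒞 i) × EndEdges (𝒞 i) e f × (∀ v → v ∈ V (𝒞 i) → v ∉ V F))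
             ⊎ (f ∉ E (𝒞 i) × IsPath (𝒞 i) × ∣ E (𝒞 i) ∣ ≡ 3 × EndEdge (𝒞 i) e
                 × (∀ v → Inc G v e → v ∉ V F)) )
    F7a : ∀ i e f → ∣ E (𝒞 i) ∣ ≡ 5 → EndEdges (𝒞 i) e f → Twinned e f
          → ∀ j → j ≢ i → IsPath (𝒞 j) → e ∈ E (𝒞 j) → ∣ E (𝒞 j) ∣ ≤ 4
    F7b : ∀ i e f → ∣ E (𝒞 i) ∣ ≡ 5 → EndEdges (𝒞 i) e f → Twinned e f
          → ∀ (w : PathW (𝒞 i) 5)
          → ∃[ j ] ∃[ k ] Σ (PathW (𝒞 j) (suc k)) λ w′ →
              vs w′ zero ≡ vs w zero × vs w′ (fromℕ (suc k)) ≡ vs w (# 4)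
              × es w′ zero ≡ es w zero × es w′ (fromℕ k) ≡ es w (# 4)

  members : Fin (m G) → Subset c
  members e = tabulate (λ i → lookup (E (𝒞 i)) e)

open Framework public

module Submission where

-- The proof rests on two local facts.  Members of 𝒞 have maximum degree two,
-- since paths and circuits admit a "trace" (an oriented listing of their edges
-- in which no vertex is twice a tail or twice a head).  And at a vertex u
-- outside F, with edges e, f, g (G is cubic), exactly two members pass through
-- u along e: by (F2) one contains e, f and one contains e, g, and by (F6) two
-- twinned edges with a common end meet F there, so no other member contains
-- e together with f or g.  Counting members then gives (2); (1) follows from
-- (F5) and (3) from (F5), (F6) and cubicity.

open import Defs
open CircW

open import Data.Bool using (Bool; _∨_)
open import Data.Bool.Properties using (∨-zeroʳ)
open import Data.Empty using (⊥; ⊥-elim)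
open import Data.Fin using (Fin; zero; suc; _≟_; inject₁; fromℕ; toℕ; opposite)
open import Data.Fin.Properties
  using (any?; suc-injective; inject₁-injective; toℕ-inject₁; toℕ-fromℕ; fromℕ≢inject₁; opposite-involutive)
open import Data.Fin.Relation.Unary.Top using (view; ‵fromℕ; ‵inject₁)
open import Data.Fin.Subset using (Subset; _∈_; _∉_; ∣_∣; inside; outside; _-_; ⁅_⁆; _∪_; _∩_; ∁) renaming (⊥ to ∅)
open import Data.Fin.Subset.Properties
  using ( ∣⊥∣≡0; ∣⁅x⁆∣≡1; x∈⁅x⁆; x∈p∪q⁺; x∈p∩q⁺; x∈p∩q⁻; x∈∁p⇒x∉p; ∈⊤; p⊆q⇒∣p∣≤∣q∣
        ; x∈p∧x≢y⇒x∈p-y; x∈p⇒∣p-x∣<∣p∣ )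
  renaming (_∈?_ to _∈ₛ?_)
open import Data.Nat using (ℕ; zero; suc; _+_; _≤_; _<_; z≤n; s≤s)
open import Data.Nat.Properties
  using ( ≤-reflexive; ≤-trans; n≤1+n; +-suc; +-monoʳ-≤; ≤-pred; ≤-antisym; <-irrefl; <⇒≱
        ; m≢1+n+m; 1+n≢n; module ≤-Reasoning )
open import Data.Product using (Σ; ∃-syntax; _×_; _,_; proj₁; proj₂; uncurry)
open import Data.Sum using (_⊎_; inj₁; inj₂; [_,_]′)
open import Data.Vec using (Vec; []; _∷_; _++_; tabulate)
open import Data.Vec.Properties using (lookup∘tabulate; []=⇒lookup; lookup⇒[]=)
open import Data.Vec.Membership.Propositional using () renaming (_∈_ to _∈ᵥ_; _∉_ to _∉ᵥ_)
open import Data.Vec.Membership.Propositional.Properties using (∈-tabulate⁺)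
open import Data.Vec.Relation.Unary.All as All using (All; []; _∷_)
open import Data.Vec.Relation.Unary.AllPairs using ([]; _∷_)
open import Data.Vec.Relation.Unary.Any using (here; there) renaming (any? to anyᵥ?)
open import Data.Vec.Relation.Unary.Unique.Propositional using (Unique)
open import Function using (_∘_; const)
open import Function.Bundles using (_⇔_; Equivalence; mk⇔)
open import Function.Properties.Equivalence using () renaming (trans to ⇔-trans)
open import Relation.Binary.PropositionalEquality
  using (_≡_; _≢_; refl; sym; trans; cong; subst; ≢-sym; module ≡-Reasoning)
open import Relation.Nullary using (¬_; Dec; yes; no; does; contradiction)
open import Relation.Nullary.Decidable using (_×-dec_; _⊎-dec_; ¬?; dec-true)

∣p∪q∣≤∣p∣+∣q∣ : ∀ {n} (p q : Subset n) → ∣ p ∪ q ∣ ≤ ∣ p ∣ + ∣ q ∣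
∣p∪q∣≤∣p∣+∣q∣ [] [] = z≤n
∣p∪q∣≤∣p∣+∣q∣ (outside ∷ p) (outside ∷ q) = ∣p∪q∣≤∣p∣+∣q∣ p q
∣p∪q∣≤∣p∣+∣q∣ (outside ∷ p) (inside ∷ q) =
  ≤-trans (s≤s (∣p∪q∣≤∣p∣+∣q∣ p q)) (≤-reflexive (sym (+-suc ∣ p ∣ ∣ q ∣)))
∣p∪q∣≤∣p∣+∣q∣ (inside ∷ p) (outside ∷ q) = s≤s (∣p∪q∣≤∣p∣+∣q∣ p q)
∣p∪q∣≤∣p∣+∣q∣ (inside ∷ p) (inside ∷ q) =
  s≤s (≤-trans (∣p∪q∣≤∣p∣+∣q∣ p q) (+-monoʳ-≤ ∣ p ∣ (n≤1+n ∣ q ∣)))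

entries : ∀ {n k} → Vec (Fin n) k → Subset n
entries [] = ∅
entries (x ∷ xs) = ⁅ x ⁆ ∪ entries xs

∣entries∣≤length : ∀ {n k} (xs : Vec (Fin n) k) → ∣ entries xs ∣ ≤ k
∣entries∣≤length {n} [] = ≤-reflexive (∣⊥∣≡0 n)
∣entries∣≤length (x ∷ xs) = begin
  ∣ ⁅ x ⁆ ∪ entries xs ∣       ≤⟨ ∣p∪q∣≤∣p∣+∣q∣ ⁅ x ⁆ (entries xs) ⟩
  ∣ ⁅ x ⁆ ∣ + ∣ entries xs ∣   ≡⟨ cong (_+ ∣ entries xs ∣) (∣⁅x⁆∣≡1 x) ⟩
  suc ∣ entries xs ∣           ≤⟨ s≤s (∣entries∣≤length xs) ⟩
  suc _                        ∎
  where open ≤-Reasoning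

∈ᵥ⇒∈entries : ∀ {n k} {x : Fin n} {xs : Vec (Fin n) k} → x ∈ᵥ xs → x ∈ entries xs
∈ᵥ⇒∈entries (here refl) = x∈p∪q⁺ (inj₁ (x∈⁅x⁆ _))
∈ᵥ⇒∈entries (there x∈xs) = x∈p∪q⁺ (inj₂ (∈ᵥ⇒∈entries x∈xs))

covered⇒∣∣≤ : ∀ {n k} (p : Subset n) (xs : Vec (Fin n) k) → (∀ {x} → x ∈ p → x ∈ᵥ xs) → ∣ p ∣ ≤ k
covered⇒∣∣≤ p xs cover = ≤-trans (p⊆q⇒∣p∣≤∣q∣ (∈ᵥ⇒∈entries ∘ cover)) (∣entries∣≤length xs)

unique⇒≤∣∣ : ∀ {n k} {p : Subset n} {xs : Vec (Fin n) k} → Unique xs → All (_∈ p) xs → k ≤ ∣ p ∣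
unique⇒≤∣∣ [] [] = z≤n
unique⇒≤∣∣ {p = p} {x ∷ xs} (x≢xs ∷ unique) (x∈p ∷ xs⊆p) =
  ≤-trans (s≤s (unique⇒≤∣∣ unique xs⊆p-x)) (x∈p⇒∣p-x∣<∣p∣ x∈p)
  where
  xs⊆p-x : All (_∈ p - x) xs
  xs⊆p-x = All.map (λ (x≢y , y∈p) → x∈p∧x≢y⇒x∈p-y y∈p (≢-sym x≢y)) (All.zip (x≢xs , xs⊆p))

_∈ᵥ?_ : ∀ {n k} (x : Fin n) (xs : Vec (Fin n) k) → Dec (x ∈ᵥ xs)
x ∈ᵥ? xs = anyᵥ? (x ≟_) xs

∉⇒All≢ : ∀ {n k} {y : Fin n} {xs : Vec (Fin n) k} → y ∉ᵥ xs → All (y ≢_) xs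
∉⇒All≢ {xs = []} _ = []
∉⇒All≢ {xs = x ∷ xs} y∉ = (y∉ ∘ here) ∷ ∉⇒All≢ (y∉ ∘ there)

fresh : ∀ {n k} (p : Subset n) (xs : Vec (Fin n) k) → k < ∣ p ∣ → ∃[ y ] (y ∈ p × All (y ≢_) xs)
fresh p xs k<∣p∣ with any? (λ y → (y ∈ₛ? p) ×-dec ¬? (y ∈ᵥ? xs))
... | yes (y , y∈p , y∉xs) = y , y∈p , ∉⇒All≢ y∉xs
... | no none = contradiction (covered⇒∣∣≤ p xs cover) (<⇒≱ k<∣p∣)
  where
  cover : ∀ {y} → y ∈ p → y ∈ᵥ xs
  cover {y} y∈p with y ∈ᵥ? xs
  ... | yes y∈xs = y∈xs
  ... | no y∉xs = contradiction (y , y∈p , y∉xs) none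

extend-distinct : ∀ {n k} {p : Subset n} d {xs : Vec (Fin n) k} → Unique xs → All (_∈ p) xs
                → d + k ≤ ∣ p ∣ → Σ (Vec (Fin n) d) λ ys → Unique (ys ++ xs) × All (_∈ p) (ys ++ xs)
extend-distinct zero unique xs⊆p _ = [] , unique , xs⊆p
extend-distinct {p = p} (suc d) unique xs⊆p d+k<∣p∣
  with extend-distinct d unique xs⊆p (≤-trans (n≤1+n _) d+k<∣p∣)
... | ys , unique′ , ys⊆p with fresh p (ys ++ _) d+k<∣p∣
...   | y , y∈p , y≢ys = y ∷ ys , y≢ys ∷ unique′ , y∈p ∷ ys⊆p

pigeonhole₂ : ∀ {A : Set} {a b x y z : A} → x ≡ a ⊎ x ≡ b → y ≡ a ⊎ y ≡ b → z ≡ a ⊎ z ≡ b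
            → ¬ Unique (x ∷ y ∷ z ∷ [])
pigeonhole₂ (inj₁ p) (inj₁ q) _ ((x≢y ∷ _) ∷ _) = x≢y (trans p (sym q))
pigeonhole₂ (inj₂ p) (inj₂ q) _ ((x≢y ∷ _) ∷ _) = x≢y (trans p (sym q))
pigeonhole₂ (inj₁ p) _ (inj₁ r) ((_ ∷ x≢z ∷ _) ∷ _) = x≢z (trans p (sym r))
pigeonhole₂ (inj₂ p) _ (inj₂ r) ((_ ∷ x≢z ∷ _) ∷ _) = x≢z (trans p (sym r))
pigeonhole₂ _ (inj₁ q) (inj₁ r) (_ ∷ (y≢z ∷ _) ∷ _) = y≢z (trans q (sym r))
pigeonhole₂ _ (inj₂ q) (inj₂ r) (_ ∷ (y≢z ∷ _) ∷ _) = y≢z (trans q (sym r))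

∈tabulate⇔ : ∀ {k} (f : Fin k → Bool) {x : Fin k} → x ∈ tabulate f ⇔ f x ≡ inside
∈tabulate⇔ f {x} = mk⇔
  (λ x∈ → trans (sym (lookup∘tabulate f x)) ([]=⇒lookup x∈))
  (λ fx → lookup⇒[]= x (tabulate f) (trans (lookup∘tabulate f x) fx))

prev : ∀ {n} → Fin (suc n) → Fin (suc n)
prev zero = fromℕ _
prev (suc i) = inject₁ i

prev-injective : ∀ {n} (i j : Fin (suc n)) → prev i ≡ prev j → i ≡ j
prev-injective zero zero _ = refl
prev-injective zero (suc j) p = contradiction p fromℕ≢inject₁
prev-injective (suc i) zero p = contradiction (sym p) fromℕ≢inject₁
prev-injective (suc i) (suc j) p = cong suc (inject₁-injective p)

prev-onto : ∀ {n} (j : Fin (suc n)) → ∃[ i ] prev i ≡ j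
prev-onto j with view j
... | ‵fromℕ = zero , refl
... | ‵inject₁ i = suc i , refl

prev²≢id : ∀ {k} (i : Fin (3 + k)) → prev (prev i) ≢ i
prev²≢id zero ()
prev²≢id (suc zero) ()
prev²≢id (suc (suc i)) p = m≢1+n+m (toℕ i) (begin
  toℕ i                        ≡⟨ toℕ-inject₁ i ⟨
  toℕ (inject₁ i)              ≡⟨ toℕ-inject₁ (inject₁ i) ⟨
  toℕ (inject₁ (inject₁ i))    ≡⟨ cong toℕ p ⟩
  suc (suc (toℕ i))            ∎)
  where open ≡-Reasoning

inject₁≢suc : ∀ {k} (i : Fin k) → inject₁ i ≢ suc i
inject₁≢suc i p = 1+n≢n (sym (trans (sym (toℕ-inject₁ i)) (cong toℕ p)))

opposite-inject₁ : ∀ {k} (i : Fin k) → opposite (inject₁ i) ≡ suc (opposite i)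
opposite-inject₁ {suc k} zero = refl
opposite-inject₁ {suc k} (suc i) = cong inject₁ (opposite-inject₁ i)

∃-opposite : ∀ {k} {P : Fin k → Set} → (∃[ i ] P i) ⇔ (∃[ i ] P (opposite i))
∃-opposite {P = P} = mk⇔ (λ (i , p) → opposite i , subst P (sym (opposite-involutive i)) p)
                         (λ (i , p) → opposite i , p)

module Incidence (Gr : Graph) where

  Vertex Edge : Set
  Vertex = Fin (n Gr)
  Edge = Fin (m Gr)

  end₁ end₂ : Edge → Vertex
  end₁ e = proj₁ (ends Gr e)
  end₂ e = proj₂ (ends Gr e)

  inc-joins : ∀ {e x y u} → Joins Gr e x y → Inc Gr u e → u ≡ x ⊎ u ≡ y
  inc-joins (inj₁ (p , q)) (inj₁ r) = inj₁ (trans r p)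
  inc-joins (inj₁ (p , q)) (inj₂ r) = inj₂ (trans r q)
  inc-joins (inj₂ (p , q)) (inj₁ r) = inj₂ (trans r p)
  inc-joins (inj₂ (p , q)) (inj₂ r) = inj₁ (trans r q)

  joins⇒inc₁ : ∀ {e x y} → Joins Gr e x y → Inc Gr x e
  joins⇒inc₁ (inj₁ (p , _)) = inj₁ (sym p)
  joins⇒inc₁ (inj₂ (_ , q)) = inj₂ (sym q)

  joins⇒inc₂ : ∀ {e x y} → Joins Gr e x y → Inc Gr y e
  joins⇒inc₂ (inj₁ (_ , q)) = inj₂ (sym q)
  joins⇒inc₂ (inj₂ (p , _)) = inj₁ (sym p)

  joins-sym : ∀ {e x y} → Joins Gr e x y → Joins Gr e y x
  joins-sym (inj₁ p) = inj₂ p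
  joins-sym (inj₂ p) = inj₁ p

  joins⇒≢ : ∀ {e x y} → Joins Gr e x y → x ≢ y
  joins⇒≢ {e} (inj₁ (p , q)) x≡y = loopless Gr e (trans p (trans x≡y (sym q)))
  joins⇒≢ {e} (inj₂ (p , q)) x≡y = loopless Gr e (trans p (trans (sym x≡y) (sym q)))

  incs⇒joins : ∀ {e u v} → Inc Gr u e → Inc Gr v e → u ≢ v → Joins Gr e u v
  incs⇒joins (inj₁ p) (inj₁ q) u≢v = contradiction (trans p (sym q)) u≢v
  incs⇒joins (inj₁ p) (inj₂ q) u≢v = inj₁ (sym p , sym q)
  incs⇒joins (inj₂ p) (inj₁ q) u≢v = inj₂ (sym q , sym p)
  incs⇒joins (inj₂ p) (inj₂ q) u≢v = contradiction (trans p (sym q)) u≢v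

  other-end : ∀ {v e} → Inc Gr v e → ∃[ u ] (Inc Gr u e × u ≢ v)
  other-end {e = e} (inj₁ v≡) = end₂ e , inj₂ refl , λ u≡v → loopless Gr e (sym (trans u≡v v≡))
  other-end {e = e} (inj₂ v≡) = end₁ e , inj₁ refl , λ u≡v → loopless Gr e (trans u≡v v≡)

  common-end-unique : ∀ {e f v w} → e ≢ f → Inc Gr v e → Inc Gr v f → Inc Gr w e → Inc Gr w f → v ≡ w
  common-end-unique {e} {f} {v} {w} e≢f ve vf we wf with v ≟ w
  ... | yes v≡w = v≡w
  ... | no v≢w = contradiction (simple Gr e f v w (incs⇒joins ve we v≢w) (incs⇒joins vf wf v≢w)) e≢f

  inc⇒∈incSet : ∀ {u h} → Inc Gr u h → h ∈ incSet Gr u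
  inc⇒∈incSet {u} {h} (inj₁ u≡) =
    Equivalence.from (∈tabulate⇔ _) (cong (_∨ does (u ≟ end₂ h)) (dec-true (u ≟ _) u≡))
  inc⇒∈incSet {u} {h} (inj₂ u≡) =
    Equivalence.from (∈tabulate⇔ _) (trans (cong (does (u ≟ end₁ h) ∨_) (dec-true (u ≟ _) u≡))
                                            (∨-zeroʳ (does (u ≟ end₁ h))))

  ∈incSet⇒inc : ∀ {u h} → h ∈ incSet Gr u → Inc Gr u h
  ∈incSet⇒inc {u} {h} h∈
    with u ≟ end₁ h | u ≟ end₂ h | Equivalence.to (∈tabulate⇔ _ {h}) h∈
  ... | yes u≡ | _ | _ = inj₁ u≡
  ... | no _ | yes u≡ | _ = inj₂ u≡
  ... | no _ | no _ | ()

  cubic-cover : Cubic Gr → ∀ {u a b c h} → Unique (a ∷ b ∷ c ∷ []) → All (Inc Gr u) (a ∷ b ∷ c ∷ [])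
              → Inc Gr u h → h ≡ a ⊎ h ≡ b ⊎ h ≡ c
  cubic-cover cubic {u} {a} {b} {c} {h} distinct incident u-h with h ∈ᵥ? (a ∷ b ∷ c ∷ [])
  ... | yes (here h≡a) = inj₁ h≡a
  ... | yes (there (here h≡b)) = inj₂ (inj₁ h≡b)
  ... | yes (there (there (here h≡c))) = inj₂ (inj₂ h≡c)
  ... | no h∉ = contradiction (subst (4 ≤_) (cubic u) four≤deg) (<-irrefl refl)
    where
    four≤deg : 4 ≤ ∣ incSet Gr u ∣
    four≤deg = unique⇒≤∣∣ (∉⇒All≢ h∉ ∷ distinct) (All.map inc⇒∈incSet (u-h ∷ incident))

  other-edges : Cubic Gr → ∀ {u e} → Inc Gr u e
             → ∃[ f ] ∃[ g ] (Unique (e ∷ f ∷ g ∷ []) × Inc Gr u f × Inc Gr u g)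
  other-edges cubic {u} u-e
    with extend-distinct 2 ([] ∷ []) (inc⇒∈incSet u-e ∷ []) (≤-reflexive (sym (cubic u)))
  ... | f ∷ g ∷ [] , (f≢g ∷ f≢e ∷ []) ∷ (g≢e ∷ []) ∷ _ , f∈ ∷ g∈ ∷ _ =
    f , g , (≢-sym f≢e ∷ ≢-sym g≢e ∷ []) ∷ (f≢g ∷ []) ∷ [] ∷ [] , ∈incSet⇒inc f∈ , ∈incSet⇒inc g∈

  cubic-outside≤2 : Cubic Gr → ∀ (S : Subset (m Gr)) {v h} → Inc Gr v h → h ∈ S
                  → ∣ ∁ S ∩ incSet Gr v ∣ ≤ 2
  cubic-outside≤2 cubic S {v} {h} v-h h∈S with other-edges cubic v-h
  ... | f , g , distinct , v-f , v-g = covered⇒∣∣≤ (∁ S ∩ incSet Gr v) (f ∷ g ∷ []) cover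
    where
    cover : ∀ {x} → x ∈ ∁ S ∩ incSet Gr v → x ∈ᵥ f ∷ g ∷ []
    cover {x} x∈ with x∈p∩q⁻ (∁ S) _ x∈
    ... | x∉S , v-x with cubic-cover cubic distinct (v-h ∷ v-f ∷ v-g ∷ []) (∈incSet⇒inc v-x)
    ... | inj₁ refl = contradiction h∈S (x∈∁p⇒x∉p x∉S)
    ... | inj₂ (inj₁ x≡f) = here x≡f
    ... | inj₂ (inj₂ x≡g) = there (here x≡g)

  end∈V : ∀ {H : Subgraph Gr} {e u} → e ∈ E H → Inc Gr u e → u ∈ V H
  end∈V {H} {e} e∈ (inj₁ refl) = proj₁ (closed H e e∈)
  end∈V {H} {e} e∈ (inj₂ refl) = proj₂ (closed H e e∈)

module Linear (Gr : Graph) where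

  open Incidence Gr

  Continues : Subgraph Gr → Vertex → Edge → Set
  Continues H u e = ∃[ h ] (h ∈ E H × h ≢ e × Inc Gr u h)

  continues? : ∀ H u e → Dec (Continues H u e)
  continues? H u e = any? λ h → (h ∈ₛ? E H) ×-dec ¬? (h ≟ e) ×-dec ((u ≟ _) ⊎-dec (u ≟ _))

  -- Paths and circuits have traces, and this is what
  -- bounds their degrees by two.
  record Trace (H : Subgraph Gr) : Set where
    field
      #vertices #edges : ℕ
      vertex : Fin #vertices → Vertex
      edge : Fin #edges → Edge
      tail head : Fin #edges → Fin #vertices
      vertex-injective : ∀ a b → vertex a ≡ vertex b → a ≡ b
      tail-injective : ∀ a b → tail a ≡ tail b → a ≡ b
      head-injective : ∀ a b → head a ≡ head b → a ≡ b
      edge-joins : ∀ i → Joins Gr (edge i) (vertex (tail i)) (vertex (head i))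
      no-2-cycle : ∀ a b → tail a ≡ head b → head a ≢ tail b
      edge-in : ∀ i → edge i ∈ E H
      edge-onto : ∀ {h} → h ∈ E H → ∃[ i ] edge i ≡ h

  module _ {H : Subgraph Gr} (T : Trace H) where

    open Trace T

    -- Distinct positions carry distinct edges: equal edges have equal ends,
    -- and a reversed pair of ends would be a 2-cycle.
    edge-injective : ∀ a b → edge a ≡ edge b → a ≡ b
    edge-injective a b ea≡eb with inc-joins (edge-joins a) (tail-b-on ea≡eb) | inc-joins (edge-joins a) (head-b-on ea≡eb)
      where
      tail-b-on : edge a ≡ edge b → Inc Gr (vertex (tail b)) (edge a)
      tail-b-on p = subst (Inc Gr _) (sym p) (joins⇒inc₁ (edge-joins b))
      head-b-on : edge a ≡ edge b → Inc Gr (vertex (head b)) (edge a)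
      head-b-on p = subst (Inc Gr _) (sym p) (joins⇒inc₂ (edge-joins b))
    ... | inj₁ tb≡ta | _ = tail-injective a b (sym (vertex-injective _ _ tb≡ta))
    ... | inj₂ tb≡ha | inj₁ hb≡ta =
      ⊥-elim (no-2-cycle a b (sym (vertex-injective _ _ hb≡ta)) (sym (vertex-injective _ _ tb≡ha)))
    ... | inj₂ tb≡ha | inj₂ hb≡ha = contradiction (trans tb≡ha (sym hb≡ha)) (joins⇒≢ (edge-joins b))

    Role : Vertex → Fin #edges → Set
    Role u i = u ≡ vertex (tail i) ⊎ u ≡ vertex (head i)

    role : ∀ {u h} → h ∈ E H → Inc Gr u h → ∃[ i ] (edge i ≡ h × Role u i)
    role h∈ u-h with edge-onto h∈
    ... | i , refl = i , refl , inc-joins (edge-joins i) u-h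

    same-tail : ∀ {u a b} → u ≡ vertex (tail a) → u ≡ vertex (tail b) → edge a ≡ edge b
    same-tail p q = cong edge (tail-injective _ _ (vertex-injective _ _ (trans (sym p) q)))

    same-head : ∀ {u a b} → u ≡ vertex (head a) → u ≡ vertex (head b) → edge a ≡ edge b
    same-head p q = cong edge (head-injective _ _ (vertex-injective _ _ (trans (sym p) q)))

    -- At most two edges of H meet any vertex: of three, two play the same role.
    at-most-two : ∀ {u e f g} → e ∈ E H → f ∈ E H → g ∈ E H → Inc Gr u e → Inc Gr u f → Inc Gr u g
              → e ≡ f ⊎ e ≡ g ⊎ f ≡ g
    at-most-two e∈ f∈ g∈ u-e u-f u-g with role e∈ u-e | role f∈ u-f | role g∈ u-g
    ... | _ , refl , inj₁ p | _ , refl , inj₁ q | _ = inj₁ (same-tail p q)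
    ... | _ , refl , inj₂ p | _ , refl , inj₂ q | _ = inj₁ (same-head p q)
    ... | _ , refl , inj₁ p | _ | _ , refl , inj₁ r = inj₂ (inj₁ (same-tail p r))
    ... | _ , refl , inj₂ p | _ | _ , refl , inj₂ r = inj₂ (inj₁ (same-head p r))
    ... | _ | _ , refl , inj₁ q | _ , refl , inj₁ r = inj₂ (inj₂ (same-tail q r))
    ... | _ | _ , refl , inj₂ q | _ , refl , inj₂ r = inj₂ (inj₂ (same-head q r))

    -- In a closed trace, where every position is both a tail and a head, H
    -- continues past each of its edges at both ends: an edge starting at u is
    -- preceded by one ending at u, and vice versa.
    closed⇒continues : (∀ p → ∃[ i ] tail i ≡ p) → (∀ p → ∃[ i ] head i ≡ p)
                     → ∀ {u e} → e ∈ E H → Inc Gr u e → Continues H u e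
    closed⇒continues tail-onto head-onto {u} e∈ u-e with role e∈ u-e
    ... | i , refl , inj₁ u≡tᵢ with head-onto (tail i)
    ...   | j , hⱼ≡tᵢ =
      edge j , edge-in j , j≢i ∘ edge-injective j i , subst (λ v → Inc Gr v (edge j)) hⱼ≡u (joins⇒inc₂ (edge-joins j))
      where
      hⱼ≡u : vertex (head j) ≡ u
      hⱼ≡u = trans (cong vertex hⱼ≡tᵢ) (sym u≡tᵢ)
      j≢i : j ≢ i
      j≢i refl = joins⇒≢ (edge-joins i) (cong vertex (sym hⱼ≡tᵢ))
    closed⇒continues tail-onto head-onto {u} e∈ u-e | i , refl , inj₂ u≡hᵢ with tail-onto (head i)
    ...   | j , tⱼ≡hᵢ =
      edge j , edge-in j , j≢i ∘ edge-injective j i , subst (λ v → Inc Gr v (edge j)) tⱼ≡u (joins⇒inc₁ (edge-joins j))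
      where
      tⱼ≡u : vertex (tail j) ≡ u
      tⱼ≡u = trans (cong vertex tⱼ≡hᵢ) (sym u≡hᵢ)
      j≢i : j ≢ i
      j≢i refl = joins⇒≢ (edge-joins i) (cong vertex tⱼ≡hᵢ)

  path-trace : ∀ {H : Subgraph Gr} {k} → PathW H k → Trace H
  path-trace {H} {k} w = record
    { #vertices = suc k ; #edges = k ; vertex = vs w ; edge = es w ; tail = inject₁ ; head = suc
    ; vertex-injective = vs-inj w
    ; tail-injective = λ _ _ → inject₁-injective
    ; head-injective = λ _ _ → suc-injective
    ; edge-joins = es-join w
    ; no-2-cycle = no-2-cycle
    ; edge-in = λ i → Equivalence.from (E-exact w (es w i)) (i , refl)
    ; edge-onto = Equivalence.to (E-exact w _)
    }
    where
    no-2-cycle : ∀ a b → inject₁ a ≡ suc b → suc a ≢ inject₁ b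
    no-2-cycle a b p q = m≢1+n+m (toℕ b) (begin
      toℕ b              ≡⟨ toℕ-inject₁ b ⟨
      toℕ (inject₁ b)    ≡⟨ cong toℕ q ⟨
      suc (toℕ a)        ≡⟨ cong suc (toℕ-inject₁ a) ⟨
      suc (toℕ (inject₁ a)) ≡⟨ cong (suc ∘ toℕ) p ⟩
      suc (suc (toℕ b))  ∎)
      where open ≡-Reasoning

  -- A circuit is traced cyclically: edge 0 is the closing edge and edge (suc j)
  -- the edge leaving vertex j, so that every edge ends at its own index.
  circuit-trace : ∀ {H : Subgraph Gr} {k} → CircW H k → Trace H
  circuit-trace {H} {k} w = record
    { #vertices = 3 + k ; #edges = 3 + k ; vertex = cvs w ; edge = edge ; tail = prev ; head = λ i → i
    ; vertex-injective = cvs-inj w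
    ; tail-injective = prev-injective
    ; head-injective = λ _ _ p → p
    ; edge-joins = edge-joins
    ; no-2-cycle = λ a b p q → prev²≢id a (trans (cong prev p) (sym q))
    ; edge-in = λ i → Equivalence.from (cE-exact w (edge i)) (index i , refl)
    ; edge-onto = λ h∈ → edge-onto (Equivalence.to (cE-exact w _) h∈)
    }
    where
    index : Fin (3 + k) → Fin (3 + k)
    index zero = fromℕ _
    index (suc j) = inject₁ j
    edge : Fin (3 + k) → Edge
    edge i = ces w (index i)
    edge-joins : ∀ i → Joins Gr (edge i) (cvs w (prev i)) (cvs w i)
    edge-joins zero = ces-close w
    edge-joins (suc j) = ces-join w j
    edge-onto : ∀ {h} → ∃[ i ] ces w i ≡ h → ∃[ i ] edge i ≡ h
    edge-onto (i , p) with view i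
    ... | ‵fromℕ = zero , p
    ... | ‵inject₁ j = suc j , p

  circuit-continues : ∀ {H : Subgraph Gr} {u e} → IsCircuit H → e ∈ E H → Inc Gr u e → Continues H u e
  circuit-continues (_ , w) = closed⇒continues (circuit-trace w) prev-onto (λ v → v , refl)

  linear-at-most-two : ∀ {H : Subgraph Gr} {u e f g} → IsPath H ⊎ IsCircuit H → e ∈ E H → f ∈ E H → g ∈ E H
                   → Inc Gr u e → Inc Gr u f → Inc Gr u g → e ≡ f ⊎ e ≡ g ⊎ f ≡ g
  linear-at-most-two (inj₁ (_ , w)) = at-most-two (path-trace w)
  linear-at-most-two (inj₂ (_ , w)) = at-most-two (circuit-trace w)

  EndEdgeAt : Subgraph Gr → Vertex → Edge → Set
  EndEdgeAt H x e = ∃[ k ] Σ (PathW H (suc k)) λ w → vs w zero ≡ x × es w zero ≡ e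

  path-size : ∀ {H : Subgraph Gr} {k} → PathW H k → ∣ E H ∣ ≤ k
  path-size {H} w = covered⇒∣∣≤ (E H) (tabulate (es w)) cover
    where
    cover : ∀ {h} → h ∈ E H → h ∈ᵥ tabulate (es w)
    cover h∈ with Equivalence.to (E-exact w _) h∈
    ... | i , refl = ∈-tabulate⁺ (es w) i

  endEdge∈ : ∀ {H : Subgraph Gr} {e} → EndEdge H e → e ∈ E H
  endEdge∈ (k , w , refl) = Equivalence.from (E-exact w _) (zero , refl)

  start-edge : ∀ {H : Subgraph Gr} {k} (w : PathW H (suc k)) i → Inc Gr (vs w zero) (es w i) → i ≡ zero
  start-edge w i v₀-eᵢ with inc-joins (es-join w i) v₀-eᵢ
  start-edge w zero v₀-eᵢ | inj₁ _ = refl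
  start-edge w (suc i) v₀-eᵢ | inj₁ p with vs-inj w _ _ p
  ... | ()
  start-edge w i v₀-eᵢ | inj₂ p with vs-inj w _ _ p
  ... | ()

  edge-at-end : ∀ {H : Subgraph Gr} {x e} → End H x → e ∈ E H → Inc Gr x e → EndEdgeAt H x e
  edge-at-end (k , w , refl) e∈ x-e with Equivalence.to (E-exact w _) e∈
  edge-at-end (suc k , w , refl) e∈ x-e | i , refl = k , w , refl , cong (es w) (sym (start-edge w i x-e))

  endEdge-stops : ∀ {H : Subgraph Gr} {x e} → EndEdgeAt H x e → ¬ Continues H x e
  endEdge-stops (k , w , refl , refl) (h , h∈ , h≢e , x-h) with Equivalence.to (E-exact w h) h∈
  ... | i , refl = h≢e (cong (es w) (start-edge w i x-h))

  continues-between : ∀ {H : Subgraph Gr} {k} (w : PathW H (suc k)) (j : Fin k)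
                    → Continues H (vs w (suc (inject₁ j))) (es w (inject₁ j))
                    × Continues H (vs w (suc (inject₁ j))) (es w (suc j))
  continues-between w j = (es w (suc j) , edge-in (suc j) , distinct ∘ sym , joins⇒inc₁ (es-join w (suc j)))
                        , (es w (inject₁ j) , edge-in (inject₁ j) , distinct , joins⇒inc₂ (es-join w (inject₁ j)))
    where
    open Trace (path-trace w) using (edge-in)
    distinct : es w (inject₁ j) ≢ es w (suc j)
    distinct = inject₁≢suc j ∘ edge-injective (path-trace w) _ _

  endEdge-continues : ∀ {H : Subgraph Gr} {x y e} → EndEdgeAt H x e → 2 ≤ ∣ E H ∣
                    → Inc Gr y e → y ≢ x → Continues H y e
  endEdge-continues (zero , w , _) 2≤∣E∣ = contradiction (≤-trans 2≤∣E∣ (path-size w)) λ { (s≤s ()) }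
  endEdge-continues {H} (suc k , w , refl , refl) _ y-e y≢x with inc-joins (es-join w zero) y-e
  ... | inj₁ y≡v₀ = contradiction y≡v₀ y≢x
  ... | inj₂ y≡v₁ = subst (λ v → Continues H v _) (sym y≡v₁) (proj₁ (continues-between w zero))

  reverse : ∀ {H : Subgraph Gr} {k} → PathW H k → PathW H k
  reverse {H} w = record
    { vs = vs w ∘ opposite
    ; es = es w ∘ opposite
    ; vs-inj = λ a b p → opposite-injective (vs-inj w _ _ p)
    ; es-join = λ i → subst (λ j → Joins Gr (es w (opposite i)) (vs w j) (vs w (opposite (suc i))))
                            (sym (opposite-inject₁ i))
                            (joins-sym (es-join w (opposite i)))
    ; V-exact = λ x → ⇔-trans (V-exact w x) ∃-opposite
    ; E-exact = λ e → ⇔-trans (E-exact w e) ∃-opposite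
    }
    where
    opposite-injective : ∀ {k} {a b : Fin k} → opposite a ≡ opposite b → a ≡ b
    opposite-injective {a = a} {b} p =
      trans (sym (opposite-involutive a)) (trans (cong opposite p) (opposite-involutive b))

  -- If a path stops at an end u of one of its edges e, then e is an end-edge:
  -- were u an inner vertex, the neighbouring edge at u would continue the path.
  stops⇒endEdge : ∀ {H : Subgraph Gr} {u e} → IsPath H → e ∈ E H → Inc Gr u e → ¬ Continues H u e → EndEdge H e
  stops⇒endEdge (k , w) e∈ u-e stops with Equivalence.to (E-exact w _) e∈
  stops⇒endEdge (suc k , w) e∈ u-e stops | i , refl with inc-joins (es-join w i) u-e
  stops⇒endEdge (suc k , w) e∈ u-e stops | zero , refl | inj₁ _ = k , w , refl
  stops⇒endEdge {H} (suc k , w) e∈ u-e stops | suc j , refl | inj₁ u≡ =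
    contradiction (subst (λ v → Continues H v _) (sym u≡) (proj₂ (continues-between w j))) stops
  stops⇒endEdge {H} (suc k , w) e∈ u-e stops | i , refl | inj₂ u≡ with view i
  ... | ‵fromℕ = k , reverse w , refl
  ... | ‵inject₁ j = contradiction (subst (λ v → Continues H v _) (sym u≡) (proj₁ (continues-between w j))) stops

  -- The two end-edges of a path with at least three edges have no common end:
  -- the first meets only positions 0 and 1, the last only positions k and k+1.
  endEdges-apart : ∀ {H : Subgraph Gr} {e f u} → EndEdges H e f → 3 ≤ ∣ E H ∣
                 → Inc Gr u e → Inc Gr u f → ⊥
  endEdges-apart (k , w , refl , refl) 3≤∣E∣ u-e u-f
    with near (inc-joins (es-join w zero) u-e) | far (inc-joins (es-join w (fromℕ k)) u-f)
    where
    near : ∀ {u} → u ≡ vs w zero ⊎ u ≡ vs w (suc zero) → ∃[ a ] (u ≡ vs w a × toℕ a ≤ 1)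
    near (inj₁ p) = _ , p , z≤n
    near (inj₂ p) = _ , p , s≤s z≤n
    far : ∀ {u} → u ≡ vs w (inject₁ (fromℕ k)) ⊎ u ≡ vs w (suc (fromℕ k))
        → ∃[ b ] (u ≡ vs w b × k ≤ toℕ b)
    far (inj₁ p) = _ , p , ≤-reflexive (sym (trans (toℕ-inject₁ (fromℕ k)) (toℕ-fromℕ k)))
    far (inj₂ p) = _ , p , ≤-trans (n≤1+n k) (s≤s (≤-reflexive (sym (toℕ-fromℕ k))))
  ... | a , u≡a , a≤1 | b , u≡b , k≤b = contradiction 2≤1 λ { (s≤s ()) }
    where
    2≤1 : 2 ≤ 1
    2≤1 = begin
      2      ≤⟨ ≤-pred (≤-trans 3≤∣E∣ (path-size w)) ⟩
      k      ≤⟨ k≤b ⟩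
      toℕ b  ≡⟨ cong toℕ (vs-inj w _ _ (trans (sym u≡b) u≡a)) ⟩
      toℕ a  ≤⟨ a≤1 ⟩
      1      ∎
      where open ≤-Reasoning

  endEdge-stops-somewhere : ∀ {H : Subgraph Gr} {e} → EndEdge H e
                          → ∃[ u ] (Inc Gr u e × ¬ Continues H u e)
  endEdge-stops-somewhere (k , w , refl) =
    vs w zero , joins⇒inc₁ (es-join w zero) , endEdge-stops (k , w , refl , refl)

  endEdge-sides : ∀ {H : Subgraph Gr} {e} → EndEdge H e → 2 ≤ ∣ E H ∣
                → (¬ Continues H (end₁ e) e × Continues H (end₂ e) e)
                ⊎ (Continues H (end₁ e) e × ¬ Continues H (end₂ e) e)
  endEdge-sides (k , w , refl) 2≤∣E∣ with joins⇒inc₁ (es-join w zero)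
  ... | inj₁ v₀≡p₁ = inj₁ ( endEdge-stops (k , w , v₀≡p₁ , refl)
                          , endEdge-continues (k , w , refl , refl) 2≤∣E∣ (inj₂ refl)
                              (λ p₂≡v₀ → loopless Gr _ (trans (sym v₀≡p₁) (sym p₂≡v₀))) )
  ... | inj₂ v₀≡p₂ = inj₂ ( endEdge-continues (k , w , refl , refl) 2≤∣E∣ (inj₁ refl)
                              (λ p₁≡v₀ → loopless Gr _ (trans p₁≡v₀ v₀≡p₂))
                          , endEdge-stops (k , w , v₀≡p₂ , refl) )

module FrameworkProperties (Φ : Framework) where

  open Incidence (G Φ)
  open Linear (G Φ)

  C : Fin (c Φ) → Subgraph (G Φ)
  C = 𝒞 Φ

  F′ : Subgraph (G Φ)
  F′ = F Φ

  ∈members⇔ : ∀ {e i} → i ∈ members Φ e ⇔ e ∈ E (C i)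
  ∈members⇔ {e} {i} = mk⇔ (λ i∈ → lookup⇒[]= e (E (C i)) (Equivalence.to (∈tabulate⇔ _) i∈))
                           (λ e∈ → Equivalence.from (∈tabulate⇔ _) ([]=⇒lookup e∈))

  member : ∀ {e i} → e ∈ E (C i) → i ∈ members Φ e
  member = Equivalence.from ∈members⇔

  kind : ∀ i → IsPath (C i) ⊎ IsCircuit (C i)
  kind i = proj₂ (proj₂ (F1 Φ i))

  at-least-two-edges : ∀ i → 2 ≤ ∣ E (C i) ∣
  at-least-two-edges i = ≤-trans (n≤1+n 2) (proj₁ (proj₂ (F1 Φ i)))

  -- On a circuit of 𝒞 the two
  -- ends would violate (F5); on a path both would be ends of the path (F5),
  -- so the path would both stop and continue at one of them.
  F-induced : ∀ {e x y} → Inc (G Φ) x e → Inc (G Φ) y e → x ≢ y → x ∈ V F′ → y ∈ V F′ → e ∈ E F′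
  F-induced {e} {x} {y} x-e y-e x≢y x∈F y∈F with e ∈ₛ? E F′
  ... | yes e∈F = e∈F
  ... | no e∉F with F2a Φ e e∉F
  ... | i , e∈Cᵢ with kind i
  ...   | inj₂ circuit = contradiction (≤-trans two≤ (proj₁ (F5a Φ i circuit))) λ { (s≤s ()) }
    where
    two≤ : 2 ≤ ∣ V (C i) ∩ V F′ ∣
    two≤ = unique⇒≤∣∣ {p = V (C i) ∩ V F′} ((x≢y ∷ []) ∷ [] ∷ [])
             (x∈p∩q⁺ (end∈V {C i} e∈Cᵢ x-e , x∈F) ∷ x∈p∩q⁺ (end∈V {C i} e∈Cᵢ y-e , y∈F) ∷ [])
  ...   | inj₁ path = ⊥-elim (endEdge-stops (edge-at-end (path-end y y-e y∈F) e∈Cᵢ y-e) continues-at-y)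
    where
    path-end : ∀ v → Inc (G Φ) v e → v ∈ V F′ → End (C i) v
    path-end v v-e v∈F = proj₁ (F5b Φ i path v (end∈V {C i} e∈Cᵢ v-e) v∈F)
    continues-at-y : Continues (C i) y e
    continues-at-y =
      endEdge-continues (edge-at-end (path-end x x-e x∈F) e∈Cᵢ x-e) (at-least-two-edges i) y-e (x≢y ∘ sym)

  end-outside-F : ∀ {e} → e ∉ E F′ → ∃[ u ] (Inc (G Φ) u e × u ∉ V F′)
  end-outside-F {e} e∉F with end₁ e ∈ₛ? V F′
  ... | no e₁∉F = end₁ e , inj₁ refl , e₁∉F
  ... | yes e₁∈F = end₂ e , inj₂ refl , e∉F ∘ F-induced (inj₁ refl) (inj₂ refl) (loopless (G Φ) e) e₁∈F

  -- Twinned edges with a common end v lie in a circuit of 𝒞, and v is in F: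
  -- the other two alternatives of (F6) contradict adjacency.
  adjacent-twins : ∀ {e f v i j} → e ≢ f → Inc (G Φ) v e → Inc (G Φ) v f → i ≢ j
                 → e ∈ E (C i) → f ∈ E (C i) → e ∈ E (C j) → f ∈ E (C j) → v ∈ V F′ × IsCircuit (C i)
  adjacent-twins {e} {f} {v} {i} {j} e≢f v-e v-f i≢j e∈i f∈i e∈j f∈j
    with proj₂ (F6 Φ e f (e≢f , i , j , i≢j , e∈i , f∈i , e∈j , f∈j) i e∈i)
  ... | inj₁ (_ , circuit , (w , w-e , w-f , w∈F) , _) =
    subst (_∈ V F′) (common-end-unique e≢f w-e w-f v-e v-f) w∈F , circuit
  ... | inj₂ (inj₁ (_ , end-edges , _)) = ⊥-elim (endEdges-apart end-edges (proj₁ (proj₂ (F1 Φ i))) v-e v-f)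
  ... | inj₂ (inj₂ (f∉i , _)) = contradiction f∈i f∉i

  one-member-outside-F : ∀ {e f u i j} → u ∉ V F′ → e ≢ f → Inc (G Φ) u e → Inc (G Φ) u f
                       → e ∈ E (C i) → f ∈ E (C i) → e ∈ E (C j) → f ∈ E (C j) → i ≡ j
  one-member-outside-F {i = i} {j} u∉F e≢f u-e u-f e∈i f∈i e∈j f∈j with i ≟ j
  ... | yes i≡j = i≡j
  ... | no i≢j = contradiction (proj₁ (adjacent-twins e≢f u-e u-f i≢j e∈i f∈i e∈j f∈j)) u∉F

  Passes : Vertex → Edge → Fin (c Φ) → Set
  Passes u e i = e ∈ E (C i) × Continues (C i) u e

  -- Through a vertex u outside F, exactly two members pass along a given edge
  -- e at u: by (F2) one with each of the two other edges f, g at u, and by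
  -- the previous lemma no other.  They differ since members have degree ≤ 2.
  two-through : ∀ {u e} → u ∉ V F′ → Inc (G Φ) u e
              → ∃[ i₁ ] ∃[ i₂ ] (i₁ ≢ i₂ × Passes u e i₁ × Passes u e i₂
                                 × (∀ {i} → Passes u e i → i ≡ i₁ ⊎ i ≡ i₂))
  two-through {u} {e} u∉F u-e with other-edges (cubic Φ) u-e
  ... | f , g , distinct@((e≢f ∷ e≢g ∷ []) ∷ (f≢g ∷ []) ∷ [] ∷ []) , u-f , u-g
    with F2b Φ e f u e≢f u-e u-f u∉F | F2b Φ e g u e≢g u-e u-g u∉F
  ... | i₁ , e∈₁ , f∈₁ | i₂ , e∈₂ , g∈₂ =
    i₁ , i₂ , i₁≢i₂ , (e∈₁ , f , f∈₁ , ≢-sym e≢f , u-f)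
                    , (e∈₂ , g , g∈₂ , ≢-sym e≢g , u-g) , only
    where
    i₁≢i₂ : i₁ ≢ i₂
    i₁≢i₂ refl with linear-at-most-two (kind i₁) e∈₁ f∈₁ g∈₂ u-e u-f u-g
    ... | inj₁ e≡f = e≢f e≡f
    ... | inj₂ (inj₁ e≡g) = e≢g e≡g
    ... | inj₂ (inj₂ f≡g) = f≢g f≡g
    only : ∀ {i} → Passes u e i → i ≡ i₁ ⊎ i ≡ i₂
    only (e∈ , h , h∈ , h≢e , u-h) with cubic-cover (cubic Φ) distinct (u-e ∷ u-f ∷ u-g ∷ []) u-h
    ... | inj₁ h≡e = contradiction h≡e h≢e
    ... | inj₂ (inj₁ refl) = inj₁ (one-member-outside-F u∉F e≢f u-e u-f e∈ h∈ e∈₁ f∈₁)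
    ... | inj₂ (inj₂ refl) = inj₂ (one-member-outside-F u∉F e≢g u-e u-g e∈ h∈ e∈₂ g∈₂)

  no-three-through : ∀ {u e} {is : Vec (Fin (c Φ)) 3} → u ∉ V F′ → Inc (G Φ) u e
                   → Unique is → All (Passes u e) is → ⊥
  no-three-through u∉F u-e distinct (p ∷ q ∷ r ∷ []) with two-through u∉F u-e
  ... | _ , _ , _ , _ , _ , only = pigeonhole₂ (only p) (only q) (only r) distinct

  -- (2) Every edge outside F lies in at least two members: the two passing
  -- through an end of it outside F.
  two≤members : ∀ {e} → e ∉ E F′ → 2 ≤ ∣ members Φ e ∣
  two≤members e∉F with end-outside-F e∉F
  ... | u , u-e , u∉F with two-through u∉F u-e
  ... | i₁ , i₂ , i₁≢i₂ , (e∈₁ , _) , (e∈₂ , _) , _ =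
    unique⇒≤∣∣ ((i₁≢i₂ ∷ []) ∷ [] ∷ []) (member e∈₁ ∷ member e∈₂ ∷ [])

  three-members : ∀ {e} → 2 < ∣ members Φ e ∣
                → Σ (Vec (Fin (c Φ)) 3) λ is → Unique is × All (λ i → e ∈ E (C i)) is
  three-members 2<∣M∣ with extend-distinct 3 [] [] 2<∣M∣
  ... | i ∷ j ∷ l ∷ [] , distinct , is⊆M = i ∷ j ∷ l ∷ [] , distinct , All.map (Equivalence.to ∈members⇔) is⊆M

  -- If v ∈ V(F) is an end of e, every member containing e passes through the
  -- other end u: a circuit continues everywhere, and a path has v as an end (F5).
  passes-far-end : ∀ {e v u i} → v ∈ V F′ → Inc (G Φ) v e → Inc (G Φ) u e → u ≢ v
                 → e ∈ E (C i) → Passes u e i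
  passes-far-end {v = v} {i = i} v∈F v-e u-e u≢v e∈ with kind i
  ... | inj₂ circuit = e∈ , circuit-continues circuit e∈ u-e
  ... | inj₁ path = e∈ , endEdge-continues (edge-at-end v-end e∈ v-e) (at-least-two-edges i) u-e u≢v
    where
    v-end : End (C i) v
    v-end = proj₁ (F5b Φ i path _ (end∈V {C i} e∈ v-e) v∈F)

  ends-outside-F : ∀ {e} → e ∉ E F′ → 2 < ∣ members Φ e ∣ → ∀ v → Inc (G Φ) v e → v ∉ V F′
  ends-outside-F e∉F 2<∣M∣ v v-e v∈F with other-end v-e | three-members 2<∣M∣
  ... | u , u-e , u≢v | _ , distinct , ∋e =
    no-three-through u∉F u-e distinct (All.map (passes-far-end v∈F v-e u-e u≢v) ∋e)
    where
    u∉F : u ∉ V F′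
    u∉F u∈F = e∉F (F-induced u-e v-e u≢v u∈F v∈F)

  stops⇒path : ∀ {e u i} → e ∈ E (C i) → Inc (G Φ) u e → ¬ Continues (C i) u e
             → IsPath (C i) × EndEdge (C i) e
  stops⇒path {i = i} e∈ u-e stops with kind i
  ... | inj₁ path = path , stops⇒endEdge path e∈ u-e stops
  ... | inj₂ circuit = contradiction (circuit-continues circuit e∈ u-e) stops

  -- (2) If e lies in more than two members, it is an end-edge of a path in 𝒞:
  -- at most two of three members containing e pass through its first end.
  some-path-end-edge : ∀ {e} → e ∉ E F′ → 2 < ∣ members Φ e ∣ → ∃[ i ] (IsPath (C i) × EndEdge (C i) e)
  some-path-end-edge {e} e∉F 2<∣M∣ with three-members 2<∣M∣
  ... | i ∷ j ∷ l ∷ [] , distinct , e∈i ∷ e∈j ∷ e∈l ∷ []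
    with continues? (C i) (end₁ e) e | continues? (C j) (end₁ e) e | continues? (C l) (end₁ e) e
  ... | no stops | _ | _ = i , stops⇒path e∈i (inj₁ refl) stops
  ... | yes _ | no stops | _ = j , stops⇒path e∈j (inj₁ refl) stops
  ... | yes _ | yes _ | no stops = l , stops⇒path e∈l (inj₁ refl) stops
  ... | yes ci | yes cj | yes cl =
    ⊥-elim (no-three-through (ends-outside-F e∉F 2<∣M∣ _ (inj₁ refl)) (inj₁ refl) distinct
                             ((e∈i , ci) ∷ (e∈j , cj) ∷ (e∈l , cl) ∷ []))

  all-paths-end-edge : ∀ {e} → e ∉ E F′ → 2 < ∣ members Φ e ∣
                     → ∀ i → e ∈ E (C i) → IsPath (C i) × EndEdge (C i) e
  all-paths-end-edge {e} e∉F 2<∣M∣ i e∈i with some-path-end-edge e∉F 2<∣M∣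
  ... | i₀ , path₀ , end₀ with i ≟ i₀
  ... | yes refl = path₀ , end₀
  ... | no i≢i₀ = path , F4c Φ i i₀ i≢i₀ path path₀ e e∈i (endEdge∈ end₀)
    where
    path : IsPath (C i)
    path = F4a Φ i₀ i e path₀ end₀ e∈i

  -- (2) Conversely, if e is an end-edge of a path of 𝒞 and both ends of e are
  -- outside F, then e lies in more than two members: the path stops at some
  -- end u of e, while two other members pass through u.
  three≤members : ∀ {e} → (∃[ i ] (IsPath (C i) × EndEdge (C i) e))
                → (∀ v → Inc (G Φ) v e → v ∉ V F′) → 2 < ∣ members Φ e ∣
  three≤members {e} (i , _ , end-edge) outside-F with endEdge-stops-somewhere end-edge
  ... | u , u-e , stops with two-through (outside-F u u-e) u-e
  ... | i₁ , i₂ , i₁≢i₂ , passes₁ , passes₂ , _ =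
    unique⇒≤∣∣ ((i≢ passes₁ ∷ i≢ passes₂ ∷ []) ∷ (i₁≢i₂ ∷ []) ∷ [] ∷ [])
               (member (endEdge∈ end-edge) ∷ member (proj₁ passes₁) ∷ member (proj₁ passes₂) ∷ [])
    where
    i≢ : ∀ {j} → Passes u e j → i ≢ j
    i≢ (_ , continues) refl = stops continues

  -- (2) If e lies in more than two members, it lies in exactly four: two pass
  -- through each end of e, and each member containing e, being a path with
  -- end-edge e, passes through exactly one end.
  four-members : ∀ {e} → e ∉ E F′ → 2 < ∣ members Φ e ∣ → ∣ members Φ e ∣ ≡ 4
  four-members {e} e∉F 2<∣M∣
    with two-through (ends-outside-F e∉F 2<∣M∣ _ (inj₁ refl)) (inj₁ refl)
       | two-through (ends-outside-F e∉F 2<∣M∣ _ (inj₂ refl)) (inj₂ refl)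
  ... | a₁ , a₂ , a₁≢a₂ , pa₁ , pa₂ , only-a | b₁ , b₂ , b₁≢b₂ , pb₁ , pb₂ , only-b =
    ≤-antisym (covered⇒∣∣≤ _ (a₁ ∷ a₂ ∷ b₁ ∷ b₂ ∷ []) cover)
              (unique⇒≤∣∣ distinct ( member (proj₁ pa₁) ∷ member (proj₁ pa₂)
                                    ∷ member (proj₁ pb₁) ∷ member (proj₁ pb₂) ∷ []))
    where
    sides : ∀ {i} → e ∈ E (C i) → (¬ Continues (C i) (end₁ e) e × Continues (C i) (end₂ e) e)
                                  ⊎ (Continues (C i) (end₁ e) e × ¬ Continues (C i) (end₂ e) e)
    sides {i} e∈ = endEdge-sides (proj₂ (all-paths-end-edge e∉F 2<∣M∣ i e∈)) (at-least-two-edges i)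
    not-both : ∀ {i j} → Passes (end₁ e) e i → Passes (end₂ e) e j → i ≢ j
    not-both (e∈ , continues₁) (_ , continues₂) refl with sides e∈
    ... | inj₁ (stops₁ , _) = stops₁ continues₁
    ... | inj₂ (_ , stops₂) = stops₂ continues₂
    distinct : Unique (a₁ ∷ a₂ ∷ b₁ ∷ b₂ ∷ [])
    distinct = (a₁≢a₂ ∷ not-both pa₁ pb₁ ∷ not-both pa₁ pb₂ ∷ [])
             ∷ (not-both pa₂ pb₁ ∷ not-both pa₂ pb₂ ∷ []) ∷ (b₁≢b₂ ∷ []) ∷ [] ∷ []
    cover : ∀ {i} → i ∈ members Φ e → i ∈ᵥ a₁ ∷ a₂ ∷ b₁ ∷ b₂ ∷ []
    cover i∈ with Equivalence.to ∈members⇔ i∈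
    ... | e∈ with sides e∈
    ...   | inj₂ (continues₁ , _) = [ here , there ∘ here ]′ (only-a (e∈ , continues₁))
    ...   | inj₁ (_ , continues₂) =
      [ there ∘ there ∘ here , there ∘ there ∘ there ∘ here ]′ (only-b (e∈ , continues₂))

  -- Otherwise v ∈ V(F) lies on a circuit of 𝒞, hence has
  -- an edge in F by (F5), which leaves at most two edges at v outside F.
  one-member-at-degree-three : ∀ {e f v i j} → e ≢ f → Inc (G Φ) v e → Inc (G Φ) v f
                             → deg (GF Φ) v ≡ 3 → e ∈ E (C i) → f ∈ E (C i) → e ∈ E (C j) → f ∈ E (C j) → i ≡ j
  one-member-at-degree-three {e} {f} {v} {i} {j} e≢f v-e v-f deg≡3 e∈i f∈i e∈j f∈j with i ≟ j
  ... | yes i≡j = i≡j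
  ... | no i≢j with adjacent-twins e≢f v-e v-f i≢j e∈i f∈i e∈j f∈j
  ... | v∈F , circuit with fresh (E F′ ∩ incSet (G Φ) v) [] (subst (0 <_) (sym degF≡1) (s≤s z≤n))
    where
    degF≡1 : deg F′ v ≡ 1
    degF≡1 = proj₂ (F5a Φ i circuit) v (end∈V {C i} e∈i v-e) v∈F
  ... | h , h∈ , _ with x∈p∩q⁻ (E F′) _ h∈
  ... | h∈F , v-h = contradiction (subst (_≤ 2) deg≡3 outside≤2) λ { (s≤s (s≤s ())) }
    where
    outside≤2 : deg (GF Φ) v ≤ 2
    outside≤2 = cubic-outside≤2 (cubic Φ) (E F′) (∈incSet⇒inc {v} v-h) h∈F

theorem3p1 : (Φ : Framework) →
  InducedIn (F Φ) whole
  × (∀ e → e ∉ E (F Φ) →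
      2 ≤ ∣ members Φ e ∣
      × (2 < ∣ members Φ e ∣ ⇔
           ((∃[ i ] (IsPath (𝒞 Φ i) × EndEdge (𝒞 Φ i) e))
            × (∀ v → Inc (G Φ) v e → v ∉ V (F Φ))))
      × (2 < ∣ members Φ e ∣ →
           ∣ members Φ e ∣ ≡ 4
           × (∀ i → e ∈ E (𝒞 Φ i) → IsPath (𝒞 Φ i) × EndEdge (𝒞 Φ i) e)))
  × (∀ e f v → e ≢ f → Inc (G Φ) v e → Inc (G Φ) v f → deg (GF Φ) v ≡ 3 →
      ∀ i j → e ∈ E (𝒞 Φ i) → f ∈ E (𝒞 Φ i) → e ∈ E (𝒞 Φ j) → f ∈ E (𝒞 Φ j) → i ≡ j)
theorem3p1 Φ =
    (const ∈⊤ , const ∈⊤ , λ e _ → F-induced (inj₁ refl) (inj₂ refl) (loopless (G Φ) e))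
  , (λ e e∉F → two≤members e∉F
             , mk⇔ (λ 2<∣M∣ → some-path-end-edge e∉F 2<∣M∣ , ends-outside-F e∉F 2<∣M∣)
                   (uncurry three≤members)
             , λ 2<∣M∣ → four-members e∉F 2<∣M∣ , all-paths-end-edge e∉F 2<∣M∣)
  , λ e f v e≢f v-e v-f deg≡3 i j → one-member-at-degree-three e≢f v-e v-f deg≡3
  where open FrameworkProperties Φ
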